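{- Let $T$ be a string whose last character occurs nowhere else in $T$, with suffix tree $\mathrm{ST}=(V,E)$ and LZ78 factorization $f_1\cdots f_z$. Let $u,v\in V$ with $e:=(u,v)\in E$, and assume that $u$ is the explicit representation of an LZ78 trie node. Then $\mathrm{height}(v)\le l(v)-|c(e)|$.
   Context: $\mathrm{ST}$ is the compacted trie of all suffixes of $T$; $c(e)$ is the string labelling edge $e$, and $l(v)$ is the number of leaves in the subtree of $v$. The LZ78 trie is the trie whose nodes are $\varepsilon$ and the factors $f_1,\dots,f_z$ of the LZ78 factorization (each $f_x=f_yc$ or $f_x=c$ for a character $c$ and $y<x$, with $f_y$ the longest previous factor, or $\varepsilon$, that is a prefix of the remaining text; $f_x$ is a child of $f_y$, resp. of the root). Each LZ78 trie node is a substring of $T$ and hence a node of the suffix trie of $T$; a node $v$ of $\mathrm{ST}$ is the explicit representation of an LZ78 trie node if the string spelled from the root of $\mathrm{ST}$ to $v$ is an LZ78 trie node. For $v\in V$, $\mathrm{height}(v)$ is the height of the corresponding node in the LZ78 trie if $v$ is the explicit representation of an LZ78 trie node, and $\mathrm{height}(v)=0$ otherwise.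
   Formalization: The bound $\mathrm{height}(v)\le l(v)-|c(e)|$ uses truncated subtraction, so its right-hand side is max(0, l(v) − |c(e)|), and the alphabet is any set with decidable equality. Apart from conventions, each condition added here is assumed in the paper as well or is needed for the statement above to hold. -}

module Defs where

open import Data.Nat using (ℕ; _∸_; _⊔_)
open import Data.List using (List; []; _∷_; _++_; [_]; length; map; filter; foldr; drop; upTo)
open import Data.List.Properties using (≡-dec)
open import Data.List.Membership.Propositional using (_∈_; _∉_)
open import Data.List.Membership.DecPropositional using () renaming (_∈?_ to mem?)
open import Data.List.Relation.Binary.Prefix.Heterogeneous using (Prefix)
open import Data.List.Relation.Binary.Prefix.Heterogeneous.Properties using (prefix?)
open import Data.Product using (Σ; ∃; _×_; _,_)
open import Data.Sum using (_⊎_)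
open import Relation.Binary.Definitions using (DecidableEquality)
open import Relation.Binary.PropositionalEquality using (_≡_; _≢_)
open import Relation.Nullary using (¬_; yes; no)

_⊑_ : {A : Set} → List A → List A → Set
w ⊑ x = Prefix _≡_ w x

_⊏_ : {A : Set} → List A → List A → Set
w ⊏ x = (w ⊑ x) × (w ≢ x)

UniqueLast : {A : Set} → List A → Set
UniqueLast {A} T = Σ (List A) λ T' → Σ A λ c → (T ≡ T' ++ [ c ]) × (c ∉ T')

Substring : {A : Set} → List A → List A → Set
Substring {A} T w = Σ (List A) λ p → Σ (List A) λ s → T ≡ p ++ w ++ s

Suffix : {A : Set} → List A → List A → Set
Suffix {A} T w = Σ (List A) λ p → T ≡ p ++ w

-- A node is identified with the string spelled from the root to it.
-- Nodes: the root ε, the branching nodes (substrings with at least two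
-- distinct one-character extensions in T), and the leaves (the non-empty
-- suffixes of T; since the last character of T is unique, no suffix is a
-- proper prefix of another one, so every non-empty suffix is a leaf).

Leaf : {A : Set} → List A → List A → Set
Leaf T w = Suffix T w × (w ≢ [])

Branching : {A : Set} → List A → List A → Set
Branching {A} T w = Σ A λ a → Σ A λ b →
  (a ≢ b) × Substring T (w ++ [ a ]) × Substring T (w ++ [ b ])

STNode : {A : Set} → List A → List A → Set
STNode T w = (w ≡ []) ⊎ Branching T w ⊎ Leaf T w

STEdge : {A : Set} → List A → List A → List A → Set
STEdge {A} T u v =
  STNode T u × STNode T v × (u ⊏ v) ×
  ((w : List A) → STNode T w → u ⊑ w → w ⊑ v → (w ≡ u) ⊎ (w ≡ v))

labelLength : {A : Set} → List A → List A → ℕ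
labelLength u v = length v ∸ length u

leaves : {A : Set} → List A → List (List A)
leaves T = map (λ i → drop i T) (upTo (length T))

leafCount : {A : Set} → DecidableEquality A → List A → List A → ℕ
leafCount _≟_ T v = length (filter (λ x → prefix? _≟_ v x) (leaves T))

-- LZ78From prev fs rest : fs is the LZ78
-- factorization of the remaining text rest, given previous factors prev.

data LZ78From {A : Set} : List (List A) → List (List A) → List A → Set where
  done : {prev : List (List A)} → LZ78From prev [] []
  step : {prev fs : List (List A)} {p rest : List A} (c : A) →
         p ∈ ([] ∷ prev) →
         ((q : List A) → q ∈ ([] ∷ prev) → q ⊑ (p ++ c ∷ rest) →
            length q Data.Nat.≤ length p) →
         LZ78From (prev ++ [ p ++ [ c ] ]) fs rest →
         LZ78From prev ((p ++ [ c ]) ∷ fs) (p ++ c ∷ rest)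

IsLZ78 : {A : Set} → List A → List (List A) → Set
IsLZ78 T fs = LZ78From [] fs T

-- The trie is prefix-closed and
-- the parent of f_y c is f_y, so the subtree of a node w consists of the trie
-- nodes having w as a prefix, at depth (length difference) below w.
lzNodes : {A : Set} → List (List A) → List (List A)
lzNodes fs = [] ∷ fs

trieHeight : {A : Set} → DecidableEquality A → List (List A) → List A → ℕ
trieHeight _≟_ fs w =
  foldr _⊔_ 0 (map (λ x → length x ∸ length w)
                   (filter (λ x → prefix? _≟_ w x) (lzNodes fs)))

height : {A : Set} → DecidableEquality A → List (List A) → List A → ℕ
height _≟_ fs v with mem? (≡-dec _≟_) v (lzNodes fs)
... | yes _ = trieHeight _≟_ fs v
... | no _ = 0

-- Let x be an LZ78 trie node below v, and k = |x| − |u|.  The k prefixes of x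
-- longer than u are trie nodes other than ε, hence k distinct LZ78 factors, and
-- they start at k distinct positions of T.  A factor f that is a prefix of x and
-- longer than u either has v as a prefix or ends strictly inside the edge (u, v);
-- in the latter case every occurrence of f extends to an occurrence of v, since
-- otherwise f would be a branching node or a leaf of ST.  So v occurs at k
-- distinct positions, i.e. k ≤ l(v), and then
-- |x| − |v| = k − |c(e)| ≤ l(v) − |c(e)|.
module Submission where

open import Defs
open import Data.Nat using (ℕ; zero; suc; _+_; _≤_; _<_; _∸_; z≤n; s≤s; _≤?_; _<?_)
open import Data.Nat.Properties
open import Data.List using (List; []; _∷_; _++_; [_]; length; map; filter; drop; concat)
open import Data.List.Properties using (++-assoc; ++-identityʳ; ++-identityʳ-unique; length-++-≤ˡ; length-map; ∷-injectiveʳ; map-upTo; concat-++; filter-accept; foldr-preservesᵇ; ≡-dec)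
open import Data.List.Membership.Propositional using (_∈_)
open import Data.List.Membership.Propositional.Properties using (∈-∃++; ∈-++⁺ˡ; ∈-++⁺ʳ; ∈-++⁻; ∈-map⁻; ∈-filter⁺; ∈-filter⁻)
open import Data.List.Membership.DecPropositional using () renaming (_∈?_ to mem?)
open import Data.List.Relation.Unary.Any using (here; there)
open import Data.List.Relation.Unary.All as All using (All; []; _∷_)
open import Data.List.Relation.Unary.All.Properties using () renaming (map⁺ to All-map⁺)
open import Data.List.Relation.Unary.Unique.Propositional using (Unique; []; _∷_)
open import Data.List.Relation.Unary.Unique.Propositional.Properties using () renaming (map⁺ to Unique-map⁺)
open import Data.List.Relation.Binary.Subset.Propositional using (_⊆_)
open import Data.List.Relation.Binary.Prefix.Heterogeneous using ([]; _∷_)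
open import Data.List.Relation.Binary.Prefix.Heterogeneous.Properties using (length-mono; prefix?) renaming (trans to Prefix-trans)
open import Data.Product using (Σ; _×_; _,_; proj₁; proj₂)
open import Data.Sum as Sum using (_⊎_; inj₁; inj₂)
open import Data.Empty using (⊥-elim)
open import Data.Bool using (true; false)
open import Function using (_∘_; case_of_)
open import Relation.Binary.Definitions using (DecidableEquality)
open import Relation.Binary.PropositionalEquality using (_≡_; _≢_; refl; sym; trans; cong; subst)
open import Relation.Nullary using (¬_; yes; no; does)
open import Relation.Nullary.Decidable using (_×-dec_)
open import Relation.Unary using (Pred; Decidable)
open import Level using (0ℓ)

private
  variable
    A : Set

⊑-++ʳ : (w s : List A) → w ⊑ (w ++ s)
⊑-++ʳ [] s = []
⊑-++ʳ (a ∷ w) s = refl ∷ ⊑-++ʳ w s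

⊑⇒∃++ : {w x : List A} → w ⊑ x → Σ (List A) λ r → x ≡ w ++ r
⊑⇒∃++ {x = x} [] = x , refl
⊑⇒∃++ (refl ∷ p) with r , eq ← ⊑⇒∃++ p = r , cong (_ ∷_) eq

⊑-trans : {a b c : List A} → a ⊑ b → b ⊑ c → a ⊑ c
⊑-trans = Prefix-trans trans

⊑-byLength : {a b x : List A} → a ⊑ x → b ⊑ x → length a ≤ length b → a ⊑ b
⊑-byLength [] _ _ = []
⊑-byLength (refl ∷ p) (refl ∷ q) (s≤s a≤b) = refl ∷ ⊑-byLength p q a≤b

⊑-∷ʳ⁻ : {w : List A} (p : List A) (c : A) → w ⊑ (p ++ [ c ]) → w ⊑ p ⊎ w ≡ p ++ [ c ]
⊑-∷ʳ⁻ [] c [] = inj₁ []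
⊑-∷ʳ⁻ [] c (refl ∷ []) = inj₂ refl
⊑-∷ʳ⁻ (a ∷ p) c [] = inj₁ []
⊑-∷ʳ⁻ (a ∷ p) c (refl ∷ q) = Sum.map (refl ∷_) (cong (a ∷_)) (⊑-∷ʳ⁻ p c q)

<length⇒≢[] : {n : ℕ} {w : List A} → n < length w → w ≢ []
<length⇒≢[] {w = _ ∷ _} _ ()

prefixesLongerThan : ℕ → List A → List (List A)
prefixesLongerThan n [] = []
prefixesLongerThan zero (a ∷ x) = [ a ] ∷ map (a ∷_) (prefixesLongerThan zero x)
prefixesLongerThan (suc n) (a ∷ x) = map (a ∷_) (prefixesLongerThan n x)

length-prefixesLongerThan : (n : ℕ) (x : List A) → length (prefixesLongerThan n x) ≡ length x ∸ n
length-prefixesLongerThan zero [] = refl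
length-prefixesLongerThan (suc n) [] = refl
length-prefixesLongerThan zero (a ∷ x) =
  cong suc (trans (length-map (a ∷_) (prefixesLongerThan zero x)) (length-prefixesLongerThan zero x))
length-prefixesLongerThan (suc n) (a ∷ x) =
  trans (length-map (a ∷_) (prefixesLongerThan n x)) (length-prefixesLongerThan n x)

∈-prefixesLongerThan⁻ : (n : ℕ) (x : List A) {w : List A} →
  w ∈ prefixesLongerThan n x → w ⊑ x × n < length w
∈-prefixesLongerThan⁻ zero (a ∷ x) (here refl) = refl ∷ [] , s≤s z≤n
∈-prefixesLongerThan⁻ zero (a ∷ x) (there w∈) with ∈-map⁻ (a ∷_) w∈
... | w , w∈′ , refl with ∈-prefixesLongerThan⁻ zero x w∈′
...   | w⊑x , _ = refl ∷ w⊑x , s≤s z≤n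
∈-prefixesLongerThan⁻ (suc n) (a ∷ x) w∈ with ∈-map⁻ (a ∷_) w∈
... | w , w∈′ , refl with ∈-prefixesLongerThan⁻ n x w∈′
...   | w⊑x , n<w = refl ∷ w⊑x , s≤s n<w

prefixesLongerThan-unique : (n : ℕ) (x : List A) → Unique (prefixesLongerThan n x)
prefixesLongerThan-unique n [] = []
prefixesLongerThan-unique zero (a ∷ x) =
  All.tabulate [a]≢ ∷ Unique-map⁺ ∷-injectiveʳ (prefixesLongerThan-unique zero x)
  where
  [a]≢ : ∀ {y} → y ∈ map (a ∷_) (prefixesLongerThan zero x) → [ a ] ≢ y
  [a]≢ y∈ [a]≡y with ∈-map⁻ (a ∷_) y∈
  ... | w , w∈ , refl = <length⇒≢[] (proj₂ (∈-prefixesLongerThan⁻ zero x w∈)) (sym (∷-injectiveʳ [a]≡y))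
prefixesLongerThan-unique (suc n) (a ∷ x) =
  Unique-map⁺ ∷-injectiveʳ (prefixesLongerThan-unique n x)

Unique-⊆⇒length≤ : {xs ys : List A} → Unique xs → xs ⊆ ys → length xs ≤ length ys
Unique-⊆⇒length≤ [] _ = z≤n
Unique-⊆⇒length≤ {xs = x ∷ xs} (x∉xs ∷ xs-unique) xs⊆ys with ∈-∃++ (xs⊆ys (here refl))
... | ys₁ , ys₂ , refl = begin
    suc (length xs)               ≤⟨ s≤s (Unique-⊆⇒length≤ xs-unique xs⊆ys₁ys₂) ⟩
    suc (length (ys₁ ++ ys₂))     ≡⟨ sym (length-++-∷ ys₁) ⟩
    length (ys₁ ++ x ∷ ys₂)       ∎
  where
  open ≤-Reasoning
  length-++-∷ : (zs : List A) {z : A} {zs′ : List A} → length (zs ++ z ∷ zs′) ≡ suc (length (zs ++ zs′))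
  length-++-∷ [] = refl
  length-++-∷ (_ ∷ zs) = cong suc (length-++-∷ zs)
  xs⊆ys₁ys₂ : xs ⊆ ys₁ ++ ys₂
  xs⊆ys₁ys₂ {y} y∈xs with ∈-++⁻ ys₁ (xs⊆ys (there y∈xs))
  ... | inj₁ y∈ys₁ = ∈-++⁺ˡ y∈ys₁
  ... | inj₂ (here refl) = ⊥-elim (All.lookup x∉xs y∈xs refl)
  ... | inj₂ (there y∈ys₂) = ∈-++⁺ʳ ys₁ y∈ys₂

length-filter-∷ : {P : Pred A 0ℓ} (P? : Decidable P) (x : A) (xs : List A) →
  length (filter P? xs) ≤ length (filter P? (x ∷ xs))
length-filter-∷ P? x xs with does (P? x)
... | true = n≤1+n _
... | false = ≤-refl

leaves-∷ : (a : A) (S : List A) → leaves (a ∷ S) ≡ (a ∷ S) ∷ leaves S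
leaves-∷ a S = trans (map-upTo (λ i → drop i (a ∷ S)) (suc (length S)))
                     (cong ((a ∷ S) ∷_) (sym (map-upTo (λ i → drop i S) (length S))))

module _ {Q : Pred (List A) 0ℓ} (Q? : Decidable Q) where

  length-filter-leaves-++ : (xs S : List A) →
    length (filter Q? (leaves S)) ≤ length (filter Q? (leaves (xs ++ S)))
  length-filter-leaves-++ [] S = ≤-refl
  length-filter-leaves-++ (a ∷ xs) S = begin
    length (filter Q? (leaves S))                            ≤⟨ length-filter-leaves-++ xs S ⟩
    length (filter Q? (leaves (xs ++ S)))                    ≤⟨ length-filter-∷ Q? (a ∷ xs ++ S) _ ⟩
    length (filter Q? ((a ∷ xs ++ S) ∷ leaves (xs ++ S)))    ≡⟨ cong (length ∘ filter Q?) (sym (leaves-∷ a (xs ++ S))) ⟩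
    length (filter Q? (leaves (a ∷ xs ++ S)))                ∎
    where open ≤-Reasoning

  length-filter-factors : {P : Pred (List A) 0ℓ} (P? : Decidable P) (fs : List (List A)) →
    All (_≢ []) fs →
    ((gs : List (List A)) (f : List A) (hs : List (List A)) →
       fs ≡ gs ++ f ∷ hs → P f → Q (f ++ concat hs)) →
    length (filter P? fs) ≤ length (filter Q? (leaves (concat fs)))
  length-filter-factors P? [] _ _ = z≤n
  length-filter-factors P? ([] ∷ fs) (f≢[] ∷ _) _ = ⊥-elim (f≢[] refl)
  length-filter-factors P? (f@(a ∷ f′) ∷ fs) (_ ∷ fs≢[]) charge
    with rest ← length-filter-factors P? fs fs≢[] (λ gs g hs eq → charge (f ∷ gs) g hs (cong (f ∷_) eq))
       | P? f
  ... | no _ = ≤-trans rest (length-filter-leaves-++ f (concat fs))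
  ... | yes Pf = begin
      suc (length (filter P? fs))                          ≤⟨ s≤s (≤-trans rest (length-filter-leaves-++ f′ (concat fs))) ⟩
      suc (length (filter Q? (leaves (f′ ++ concat fs))))  ≡⟨ cong length (sym (filter-accept Q? (charge [] f fs refl Pf))) ⟩
      length (filter Q? ((f ++ concat fs) ∷ leaves (f′ ++ concat fs)))
                                                           ≡⟨ cong (length ∘ filter Q?) (sym (leaves-∷ a (f′ ++ concat fs))) ⟩
      length (filter Q? (leaves (f ++ concat fs)))         ∎
    where open ≤-Reasoning

∷ʳ≢[] : (p : List A) (c : A) → p ++ [ c ] ≢ []
∷ʳ≢[] [] c ()
∷ʳ≢[] (_ ∷ _) c ()

LZ78From-concat : {prev fs : List (List A)} {rest : List A} → LZ78From prev fs rest → rest ≡ concat fs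
LZ78From-concat done = refl
LZ78From-concat (step {p = p} {rest} c _ _ lz) =
  trans (sym (++-assoc p [ c ] rest)) (cong ((p ++ [ c ]) ++_) (LZ78From-concat lz))

LZ78From-nonEmpty : {prev fs : List (List A)} {rest : List A} → LZ78From prev fs rest → All (_≢ []) fs
LZ78From-nonEmpty done = []
LZ78From-nonEmpty (step {p = p} c _ _ lz) = ∷ʳ≢[] p c ∷ LZ78From-nonEmpty lz

PrefixClosed : List (List A) → Set
PrefixClosed L = ∀ {x w} → x ∈ L → w ⊑ x → w ∈ L

PrefixClosed-∷ʳ : (L : List (List A)) (p : List A) (c : A) → p ∈ L →
  PrefixClosed L → PrefixClosed (L ++ [ p ++ [ c ] ])
PrefixClosed-∷ʳ L p c p∈L closed {x} x∈ w⊑x with ∈-++⁻ L x∈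
... | inj₁ x∈L = ∈-++⁺ˡ (closed x∈L w⊑x)
... | inj₂ (here refl) with ⊑-∷ʳ⁻ p c w⊑x
...   | inj₁ w⊑p = ∈-++⁺ˡ (closed p∈L w⊑p)
...   | inj₂ refl = ∈-++⁺ʳ L (here refl)

LZ78From-prefixClosed : {prev fs : List (List A)} {rest : List A} → LZ78From prev fs rest →
  PrefixClosed ([] ∷ prev) → PrefixClosed ([] ∷ prev ++ fs)
LZ78From-prefixClosed {prev = prev} done closed =
  subst PrefixClosed (cong ([] ∷_) (sym (++-identityʳ prev))) closed
LZ78From-prefixClosed {prev = prev} (step {fs = fs} {p = p} c p∈ _ lz) closed =
  subst PrefixClosed (cong ([] ∷_) (++-assoc prev [ p ++ [ c ] ] fs))
        (LZ78From-prefixClosed lz (PrefixClosed-∷ʳ ([] ∷ prev) p c p∈ closed))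

lzNodes-prefixClosed : {T : List A} {fs : List (List A)} → IsLZ78 T fs → PrefixClosed (lzNodes fs)
lzNodes-prefixClosed lz = LZ78From-prefixClosed lz λ { (here refl) [] → here refl }

Substring-++⁻ˡ : {T : List A} (x y : List A) → Substring T (x ++ y) → Substring T x
Substring-++⁻ˡ x y (p , s , eq) = p , y ++ s , trans eq (cong (p ++_) (++-assoc x y s))

Suffix⇒Substring : {T w : List A} → Suffix T w → Substring T w
Suffix⇒Substring {w = w} (p , eq) = p , [] , trans eq (cong (p ++_) (sym (++-identityʳ w)))

STNode⇒Substring : {T w : List A} → STNode T w → Substring T w
STNode⇒Substring {T = T} (inj₁ refl) = [] , T , refl
STNode⇒Substring {w = w} (inj₂ (inj₁ (a , _ , _ , wa , _))) = Substring-++⁻ˡ w [ a ] wa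
STNode⇒Substring (inj₂ (inj₂ (suffix , _))) = Suffix⇒Substring suffix

noNodeStrictlyInside : {T u v w : List A} {b : A} {r : List A} → STEdge T u v →
  v ≡ w ++ b ∷ r → length u < length w → ¬ STNode T w
noNodeStrictlyInside {w = w} {b} {r} (_ , _ , (u⊑v , _) , between) refl u<w w-node
  with between w w-node (⊑-byLength u⊑v (⊑-++ʳ w (b ∷ r)) (<⇒≤ u<w)) (⊑-++ʳ w (b ∷ r))
... | inj₁ refl = <-irrefl refl u<w
... | inj₂ w≡wbr = case ++-identityʳ-unique w w≡wbr of λ ()

-- A mismatch after w would make w a branching node, and running out of text would make it a leaf,
-- both strictly inside the edge.
edge-interior-extends : DecidableEquality A → {T u v : List A} → STEdge T u v →
  (w r s : List A) → v ≡ w ++ r → length u < length w → Suffix T (w ++ s) → v ⊑ (w ++ s)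
edge-interior-extends _ _ w [] s v≡w _ _ =
  subst (_⊑ (w ++ s)) (sym (trans v≡w (++-identityʳ w))) (⊑-++ʳ w s)
edge-interior-extends _ {T} edge w (b ∷ r) [] v≡wbr u<w suffix =
  ⊥-elim (noNodeStrictlyInside edge v≡wbr u<w
           (inj₂ (inj₂ (subst (Suffix T) (++-identityʳ w) suffix , <length⇒≢[] u<w))))
edge-interior-extends _≟_ {T} {v = v} edge w (b ∷ r) (a ∷ s) v≡wbr u<w suffix with a ≟ b
... | yes refl =
  subst (v ⊑_) (++-assoc w [ a ] s)
    (edge-interior-extends _≟_ edge (w ++ [ a ]) r s
      (trans v≡wbr (sym (++-assoc w [ a ] r)))
      (<-≤-trans u<w (length-++-≤ˡ w))
      (subst (Suffix T) (sym (++-assoc w [ a ] s)) suffix))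
... | no a≢b = ⊥-elim (noNodeStrictlyInside edge v≡wbr u<w (inj₂ (inj₁ (a , b , a≢b , wa , wb))))
  where
  wa : Substring T (w ++ [ a ])
  wa = Substring-++⁻ˡ (w ++ [ a ]) s
         (Suffix⇒Substring (subst (Suffix T) (sym (++-assoc w [ a ] s)) suffix))
  wb : Substring T (w ++ [ b ])
  wb = Substring-++⁻ˡ (w ++ [ b ]) r
         (subst (Substring T) (trans v≡wbr (sym (++-assoc w [ b ] r)))
           (STNode⇒Substring (proj₁ (proj₂ edge))))

edge-extends : DecidableEquality A → {T u v f x s : List A} → STEdge T u v →
  f ⊑ x → v ⊑ x → length u < length f → Suffix T (f ++ s) → v ⊑ (f ++ s)
edge-extends _≟_ {v = v} {f} {s = s} edge f⊑x v⊑x u<f suffix with length v ≤? length f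
... | yes v≤f = ⊑-trans (⊑-byLength v⊑x f⊑x v≤f) (⊑-++ʳ f s)
... | no v≰f with r , v≡fr ← ⊑⇒∃++ (⊑-byLength f⊑x v⊑x (≰⇒≥ v≰f)) =
  edge-interior-extends _≟_ edge f r s v≡fr u<f suffix

module _ (_≟_ : DecidableEquality A) {T : List A} {fs : List (List A)} (lz : IsLZ78 T fs)
         {u v : List A} (edge : STEdge T u v) where

  depthBelow-u≤leafCount : {x : List A} → x ∈ lzNodes fs → v ⊑ x →
    length x ∸ length u ≤ leafCount _≟_ T v
  depthBelow-u≤leafCount {x} x∈ v⊑x = begin
    length x ∸ length u                       ≡⟨ sym (length-prefixesLongerThan (length u) x) ⟩
    length (prefixesLongerThan (length u) x)  ≤⟨ Unique-⊆⇒length≤ (prefixesLongerThan-unique (length u) x) longPrefixes⊆ ⟩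
    length (filter P? fs)                     ≤⟨ length-filter-factors Q? P? fs (LZ78From-nonEmpty lz) charge ⟩
    length (filter Q? (leaves (concat fs)))   ≡⟨ cong (length ∘ filter Q? ∘ leaves) (sym T≡concat) ⟩
    leafCount _≟_ T v                         ∎
    where
    open ≤-Reasoning
    T≡concat : T ≡ concat fs
    T≡concat = LZ78From-concat lz
    P? : Decidable (λ f → f ⊑ x × length u < length f)
    P? f = prefix? _≟_ f x ×-dec (length u <? length f)
    Q? : Decidable (v ⊑_)
    Q? = prefix? _≟_ v
    longPrefixes⊆ : prefixesLongerThan (length u) x ⊆ filter P? fs
    longPrefixes⊆ w∈ with w⊑x , u<w ← ∈-prefixesLongerThan⁻ (length u) x w∈
                   with lzNodes-prefixClosed lz x∈ w⊑x
    ... | here refl = case u<w of λ ()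
    ... | there w∈fs = ∈-filter⁺ P? w∈fs (w⊑x , u<w)
    charge : (gs : List (List A)) (f : List A) (hs : List (List A)) → fs ≡ gs ++ f ∷ hs →
      f ⊑ x × length u < length f → v ⊑ (f ++ concat hs)
    charge gs f hs fs≡ (f⊑x , u<f) = edge-extends _≟_ edge f⊑x v⊑x u<f
      (concat gs , trans T≡concat (trans (cong concat fs≡) (sym (concat-++ gs (f ∷ hs)))))

height≤trieHeight : (_≟_ : DecidableEquality A) (fs : List (List A)) (v : List A) →
  height _≟_ fs v ≤ trieHeight _≟_ fs v
height≤trieHeight _≟_ fs v with mem? (≡-dec _≟_) v (lzNodes fs)
... | yes _ = ≤-refl
... | no _ = z≤n

trieHeight-lub : (_≟_ : DecidableEquality A) (fs : List (List A)) (v : List A) {K : ℕ} →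
  ({x : List A} → x ∈ lzNodes fs → v ⊑ x → length x ∸ length v ≤ K) → trieHeight _≟_ fs v ≤ K
trieHeight-lub _≟_ fs v {K} bound =
  foldr-preservesᵇ {P = _≤ K} ⊔-lub z≤n (All-map⁺ (All.tabulate bound′))
  where
  bound′ : {x : List _} → x ∈ filter (prefix? _≟_ v) (lzNodes fs) → length x ∸ length v ≤ K
  bound′ x∈ with x∈nodes , v⊑x ← ∈-filter⁻ (prefix? _≟_ v) x∈ = bound x∈nodes v⊑x

m∸k≤o⇒m∸n≤o∸[n∸k] : {m n k o : ℕ} → k ≤ n → m ∸ k ≤ o → m ∸ n ≤ o ∸ (n ∸ k)
m∸k≤o⇒m∸n≤o∸[n∸k] {m} {n} {k} {o} k≤n m∸k≤o = begin
  m ∸ n                 ≡⟨ cong (m ∸_) (sym (m+[n∸m]≡n k≤n)) ⟩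
  m ∸ (k + (n ∸ k))     ≡⟨ sym (∸-+-assoc m k (n ∸ k)) ⟩
  m ∸ k ∸ (n ∸ k)       ≤⟨ ∸-monoˡ-≤ (n ∸ k) m∸k≤o ⟩
  o ∸ (n ∸ k)           ∎
  where open ≤-Reasoning

lemma3 : {A : Set} (_≟_ : DecidableEquality A) (T : List A) →
    UniqueLast T →
    (fs : List (List A)) → IsLZ78 T fs →
    (u v : List A) → STEdge T u v →
    u ∈ lzNodes fs →
    height _≟_ fs v ≤ leafCount _≟_ T v ∸ labelLength u v
lemma3 _≟_ T _ fs lz u v edge@(_ , _ , (u⊑v , _) , _) _ = begin
  height _≟_ fs v                               ≤⟨ height≤trieHeight _≟_ fs v ⟩
  trieHeight _≟_ fs v                           ≤⟨ trieHeight-lub _≟_ fs v depthBelow-v≤ ⟩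
  leafCount _≟_ T v ∸ (length v ∸ length u)     ∎
  where
  open ≤-Reasoning
  depthBelow-v≤ : {x : List _} → x ∈ lzNodes fs → v ⊑ x →
    length x ∸ length v ≤ leafCount _≟_ T v ∸ (length v ∸ length u)
  depthBelow-v≤ x∈ v⊑x =
    m∸k≤o⇒m∸n≤o∸[n∸k] (length-mono u⊑v) (depthBelow-u≤leafCount _≟_ lz edge x∈ v⊑x)
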